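{- Let $\mathcal{F}=\langle E,H,\sim\rangle$ be any ETL frame (with $\sim$ an arbitrary binary relation on $H$). If $\mathcal{F}$ has $\mathsf{PR_{hc}^\ell}$, then $\mathcal{F}$ has $\mathsf{PR_{hc}}$.
   Context: Fix a finite set $E$ of events. A history is a finite sequence of events. For histories $h,h'$ write $h\leadsto h'$ if $h'=he$ for some event $e$, and $\leadsto^*$ for its reflexive–transitive closure (prefix relation). A protocol $H$ is a finite prefix-closed set of histories. An ETL frame is $\langle E,H,\sim\rangle$ with $\sim\subseteq H\times H$ arbitrary; all histories range over $H$. $\mathsf{PR_{hc}}$: for all histories $h,h'$ and events $e$ with $he\sim h'$ there is $h''$ with $h\sim h''\leadsto^* h'$. $\mathsf{PR_{hc}^\ell}$: for all histories $h,h'$ and events $e$ with $he\sim h'$, at least one of the following holds: (i) $h\sim h'$; (ii) there is $h''$ with $h\sim h''\leadsto h'$; (iii) there is $h''$ with $he\sim h''\leadsto h'$. -}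

module Defs where

open import Data.Nat using (ℕ)
open import Data.Fin using (Fin)
open import Data.List using (List; []; _∷_; _++_; [_])
open import Data.List.Membership.Propositional using (_∈_)
open import Data.Product using (Σ; ∃; ∃-syntax; _×_; _,_)
open import Data.Sum using (_⊎_)
open import Relation.Binary.PropositionalEquality using (_≡_)
open import Function.Bundles using (_⇔_)
open import Level using (Level; suc; _⊔_; 0ℓ)

Event : ℕ → Set
Event n = Fin n

History : ℕ → Set
History n = List (Event n)

_↝_ : ∀ {n} → History n → History n → Set
h ↝ h' = ∃[ e ] (h' ≡ h ++ [ e ])

data _↝*_ {n : ℕ} : History n → History n → Set where
  ↝*-refl : ∀ {h} → h ↝* h
  ↝*-step : ∀ {h h' h''} → h ↝ h' → h' ↝* h'' → h ↝* h''

record ETLFrame (n : ℕ) : Set₁ where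
  field
    H : History n → Set
    H-prefix-closed : ∀ {h h'} → h ↝* h' → H h' → H h
    H-finite : Σ (List (History n)) λ L → ∀ h → (H h ⇔ (h ∈ L))
    _∼_ : History n → History n → Set
    ∼-in-H : ∀ {h h'} → h ∼ h' → H h × H h'

open ETLFrame public

PRhc : ∀ {n} → ETLFrame n → Set
PRhc {n} F =
  ∀ (h h' : History n) (e : Event n) →
  H F h → H F h' → H F (h ++ [ e ]) →
  _∼_ F (h ++ [ e ]) h' →
  ∃[ h'' ] (H F h'' × _∼_ F h h'' × h'' ↝* h')

PRhcℓ : ∀ {n} → ETLFrame n → Set
PRhcℓ {n} F =
  ∀ (h h' : History n) (e : Event n) →
  H F h → H F h' → H F (h ++ [ e ]) →
  _∼_ F (h ++ [ e ]) h' →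
  (_∼_ F h h')
  ⊎ (∃[ h'' ] (H F h'' × _∼_ F h h'' × h'' ↝ h'))
  ⊎ (∃[ h'' ] (H F h'' × _∼_ F (h ++ [ e ]) h'' × h'' ↝ h'))

-- Iterate PR_hc^ℓ backwards: while case (iii) occurs, replace h' by its
-- immediate predecessor h'' with he ∼ h''. Histories shrink at each step, so
-- eventually case (i) or (ii) occurs, giving h ∼ g with g a prefix of h'.
module Submission where

open import Data.Nat using (ℕ; _<_)
open import Data.Nat.Induction using (<-wellFounded)
open import Data.Nat.Properties using (m<m+n; 0<1+n)
open import Data.List using (length; _++_; [_])
open import Data.List.Properties using (length-++)
open import Data.Product using (∃-syntax; _×_; _,_)
open import Data.Sum using (_⊎_; inj₁; inj₂)
open import Induction.WellFounded using (WellFounded; Acc; acc; module Subrelation)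
import Relation.Binary.Construct.On as On
open import Relation.Binary.PropositionalEquality using (refl; subst; sym)
open import Relation.Unary using (Pred)
open import Level using (Level)
open import Defs

module _ {n : ℕ} where

  ↝*-trans : {a b c : History n} → a ↝* b → b ↝* c → a ↝* c
  ↝*-trans ↝*-refl        q = q
  ↝*-trans (↝*-step s p) q = ↝*-step s (↝*-trans p q)

  ↝*-stepʳ : {a b c : History n} → a ↝* b → b ↝ c → a ↝* c
  ↝*-stepʳ p s = ↝*-trans p (↝*-step s ↝*-refl)

  ↝⇒length< : {a b : History n} → a ↝ b → length a < length b
  ↝⇒length< {a} (e , refl) =
    subst (length a <_) (sym (length-++ a)) (m<m+n (length a) 0<1+n)

  ↝-wellFounded : WellFounded (_↝_ {n})
  ↝-wellFounded =
    Subrelation.wellFounded ↝⇒length< (On.wellFounded length <-wellFounded)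

  ↝-backward-induction : ∀ {p q : Level} (P : Pred (History n) p) (Q : Pred (History n) q) →
    (∀ {h'} → P h' → Q h' ⊎ (∃[ g ] (Q g × g ↝ h')) ⊎ (∃[ g ] (P g × g ↝ h'))) →
    ∀ {h'} → P h' → ∃[ g ] (Q g × g ↝* h')
  ↝-backward-induction P Q step {h'} = go (↝-wellFounded h')
    where
    go : ∀ {h'} → Acc _↝_ h' → P h' → ∃[ g ] (Q g × g ↝* h')
    go {h'} (acc rec) Ph' with step Ph'
    ... | inj₁ Qh'                  = h' , Qh' , ↝*-refl
    ... | inj₂ (inj₁ (g , Qg , s)) = g , Qg , ↝*-step s ↝*-refl
    ... | inj₂ (inj₂ (g , Pg , s)) with go (rec s) Pg
    ...   | g′ , Qg′ , g′↝*g        = g′ , Qg′ , ↝*-stepʳ g′↝*g s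

lemma1 : ∀ (n : ℕ) (F : ETLFrame n) → PRhcℓ F → PRhc F
lemma1 n F prℓ h h' e Hh Hh' Hhe he∼h' =
  let g , (Hg , h∼g) , g↝*h' =
        ↝-backward-induction (Related (h ++ [ e ])) (Related h) step (Hh' , he∼h')
  in g , Hg , h∼g , g↝*h'
  where
  Related : History n → Pred (History n) _
  Related a g = H F g × _∼_ F a g

  step : ∀ {g} → Related (h ++ [ e ]) g →
    Related h g ⊎ (∃[ g′ ] (Related h g′ × g′ ↝ g))
                ⊎ (∃[ g′ ] (Related (h ++ [ e ]) g′ × g′ ↝ g))
  step (Hg , he∼g) with prℓ h _ e Hh Hg Hhe he∼g
  ... | inj₁ h∼g                          = inj₁ (Hg , h∼g)
  ... | inj₂ (inj₁ (g′ , Hg′ , h∼g′ , s))  = inj₂ (inj₁ (g′ , (Hg′ , h∼g′) , s))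
  ... | inj₂ (inj₂ (g′ , Hg′ , he∼g′ , s)) = inj₂ (inj₂ (g′ , (Hg′ , he∼g′) , s))
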